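{- If an infinitary propositional formula over the set of precomputed atoms is provable in $HT^\infty+gr(\mathit{Defs})$, then it is provable in $HT^\infty$.
   Context: **Precomputed terms and atoms.** Precomputed terms are numerals $\overline n$ (in bijection with the integers $n$), symbolic constants, and the symbols $\mathit{inf}$, $\mathit{sup}$, totally ordered with least element $\mathit{inf}$, greatest $\mathit{sup}$, and numerals contiguous and ordered as the integers. A precomputed atom is $p(\mathbf r)$ with $p$ a symbolic constant and $\mathbf r$ a tuple of precomputed terms. **Infinitary propositional formulas** over a set of atoms: every atom; $\mathcal H^\wedge$ and $\mathcal H^\vee$ for any set $\mathcal H$ of formulas; $F\to G$. $\bot=\emptyset^\vee$, $\top=\emptyset^\wedge$, $\neg F=F\to\bot$, $F\leftrightarrow G=(F\to G)\wedge(G\to F)$. **First-order language.** Two sorts, general and its subsort integer; integer variables range over numerals. Signature $\sigma_0$: all precomputed terms as object constants (integer sort iff numerals); $+,-,\times$ as binary function symbols on the integer sort; for each symbolic constant $p$ and $n\ge0$ an $n$-ary predicate constant $p/n$ (written $p(\mathbf t)$); the comparison symbols $=,\ne,<,>,\le,\ge$ as binary predicate constants. Signature $\sigma_1$ adds predicate constants $\mathit{Atleast}^{\mathbf X;\mathbf V}_F$ and $\mathit{Atmost}^{\mathbf X;\mathbf V}_F$ for all disjoint lists $\mathbf X,\mathbf V$ of distinct general variables and all $\sigma_0$-formulas $F$ whose free variables are in $\mathbf X$ or $\mathbf V$; each has $|\mathbf V|+1$ arguments of sort general. **Counting formulas and Defs.** For a $\sigma_0$-formula $F$, a list $\mathbf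 X$, fresh tuples $\mathbf X_i$ of general variables (tuple equality is componentwise conjunction), and precomputed $r$: $\exists_{\ge r}\mathbf XF$ is $\exists\mathbf X_1\cdots\mathbf X_n(\bigwedge_{i=1}^nF^{\mathbf X}_{\mathbf X_i}\wedge\bigwedge_{i<j}\neg(\mathbf X_i=\mathbf X_j))$ if $r=\overline n,n>0$; $\top$ if $r\le\overline0$; $\bot$ if $r>\overline n$ for all integers $n$. $\exists_{\le r}\mathbf XF$ is $\forall\mathbf X_1\cdots\mathbf X_{n+1}(\bigwedge_{i=1}^{n+1}F^{\mathbf X}_{\mathbf X_i}\to\bigvee_{i<j}\mathbf X_i=\mathbf X_j)$ if $r=\overline n,n\ge0$; $\bot$ if $r<\overline0$; $\top$ if $r>\overline n$ for all $n$. $\mathit{Defs}$ is the set of all $\sigma_1$-sentences $\forall\mathbf V(\mathit{Atleast}^{\mathbf X;\mathbf V}_F(\mathbf V,r)\leftrightarrow\exists_{\ge r}\mathbf XF)$ and $\forall\mathbf V(\mathit{Atmost}^{\mathbf X;\mathbf V}_F(\mathbf V,r)\leftrightarrow\exists_{\le r}\mathbf XF)$ for all such predicate constants and all precomputed terms $r$. **Grounding $gr$** maps $\sigma_1$-sentences to infinitary formulas whose atoms are $p(\mathbf r)$ with $p$ a non-comparison predicate constant of $\sigma_1$ and $\mathbf r$ precomputed terms (ground terms are evaluated by integer arithmetic): $gr(\bot)=\bot$; $gr(t_1\prec t_2)$ is $\top$ if the comparison $\prec$ holds between the values of $t_1,t_2$ in the fixed order, $\bot$ otherwise; $gr(p(\mathbf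 t))$ replaces each term by its value; $gr(F\odot G)=gr(F)\odot gr(G)$ for binary connectives; $gr(\forall XF)$ / $gr(\exists XF)$ is the conjunction / disjunction of $gr(F^X_r)$ over all precomputed terms $r$ ($X$ general) or all numerals $r$ ($X$ integer). $gr(\mathit{Defs})=\{gr(D):D\in\mathit{Defs}\}$. **$HT^\infty$.** Derivable objects are sequents $\Gamma\Rightarrow F$ with $\Gamma$ a finite set of infinitary formulas ($\Rightarrow F$ identified with $F$). Axioms: $F\Rightarrow F$; $F\vee(F\to G)\vee\neg G$; $\bigwedge_{\alpha\in A}\bigvee_{F\in\mathcal H_\alpha}F\to\bigvee_{(F_\alpha)_{\alpha\in A}}\bigwedge_{\alpha\in A}F_\alpha$ for every non-empty family $(\mathcal H_\alpha)_{\alpha\in A}$ of sets of formulas (disjunction over the Cartesian product). Rules: ($\wedge I$) from $\Gamma\Rightarrow H$ for all $H\in\mathcal H$ infer $\Gamma\Rightarrow\mathcal H^\wedge$; ($\wedge E$) from $\Gamma\Rightarrow\mathcal H^\wedge$ infer $\Gamma\Rightarrow H$ ($H\in\mathcal H$); ($\vee I$) from $\Gamma\Rightarrow H$ ($H\in\mathcal H$) infer $\Gamma\Rightarrow\mathcal H^\vee$; ($\vee E$) from $\Gamma\Rightarrow\mathcal H^\vee$ and $\Delta,H\Rightarrow F$ for all $H\in\mathcal H$ infer $\Gamma,\Delta\Rightarrow F$; ($\to I$) from $\Gamma,F\Rightarrow G$ infer $\Gamma\Rightarrow F\to G$; ($\to E$) from $\Gamma\Rightarrow F$ and $\Delta\Rightarrow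 F\to G$ infer $\Gamma,\Delta\Rightarrow G$; (W) from $\Gamma\Rightarrow F$ infer $\Gamma,\Delta\Rightarrow F$. A formula is provable in $HT^\infty$ if it is a theorem; $HT^\infty+gr(\mathit{Defs})$ is $HT^\infty$ with every formula of $gr(\mathit{Defs})$ added as an axiom. -}

module Defs where

open import Level using (Lift)
open import Data.Empty using (⊥; ⊥-elim)
open import Data.Unit using (⊤)
open import Data.Bool using (Bool; true; false; not; _∧_; _∨_; if_then_else_)
open import Data.Nat as ℕ using (ℕ; zero; suc; _+_; _*_; _⊔_; _≡ᵇ_; _<ᵇ_)
open import Data.Integer as ℤ using (ℤ; +_; -[1+_])
open import Data.Product using (_×_; _,_)
open import Data.Sum using (_⊎_; inj₁; inj₂)
open import Data.List using (List; []; _∷_; _++_; map; foldr; concatMap; length; upTo; zip)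
open import Data.Vec as Vec using (Vec)
open import Data.List.Relation.Unary.Unique.Propositional using (Unique)
open import Data.List.Relation.Binary.Subset.Propositional using (_⊆_)
open import Relation.Nullary using (does)
open import Relation.Binary.PropositionalEquality using (_≡_)

data PTerm : Set where
  inf : PTerm
  num : ℤ → PTerm
  sym : ℕ → PTerm
  sup : PTerm

ltP : PTerm → PTerm → Bool
ltP inf inf = false
ltP inf _ = true
ltP (num _) inf = false
ltP (num m) (num n) = does (m ℤ.<? n)
ltP (num _) (sym _) = true
ltP (num _) sup = true
ltP (sym _) inf = false
ltP (sym _) (num _) = false
ltP (sym m) (sym n) = m <ᵇ n
ltP (sym _) sup = true
ltP sup _ = false

eqP : PTerm → PTerm → Bool
eqP inf inf = true
eqP (num m) (num n) = does (m ℤ.≟ n)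
eqP (sym m) (sym n) = m ≡ᵇ n
eqP sup sup = true
eqP _ _ = false

data PAtom : Set where
  patom : ℕ → List PTerm → PAtom

-- Infinitary propositional formulas over a set A of atoms.
-- A set 𝓗 of formulas is given as an indexed family (I , H : I → Form A).

data Form (A : Set) : Set₁ where
  atom : A → Form A
  ⋀    : (I : Set) → (I → Form A) → Form A
  ⋁    : (I : Set) → (I → Form A) → Form A
  _⇒_  : Form A → Form A → Form A

infixr 5 _⇒_

module _ {A : Set} where
  ⊥∞ : Form A
  ⊥∞ = ⋁ ⊥ ⊥-elim

  ⊤∞ : Form A
  ⊤∞ = ⋀ ⊥ ⊥-elim

  ¬∞ : Form A → Form A
  ¬∞ F = F ⇒ ⊥∞

  _∧∞_ : Form A → Form A → Form A
  F ∧∞ G = ⋀ Bool (λ b → if b then F else G)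

  _∨∞_ : Form A → Form A → Form A
  F ∨∞ G = ⋁ Bool (λ b → if b then F else G)

  _⇔∞_ : Form A → Form A → Form A
  F ⇔∞ G = (F ⇒ G) ∧∞ (G ⇒ F)

mapAtoms : {A B : Set} → (A → B) → Form A → Form B
mapAtoms f (atom a) = atom (f a)
mapAtoms f (⋀ I H) = ⋀ I (λ i → mapAtoms f (H i))
mapAtoms f (⋁ I H) = ⋁ I (λ i → mapAtoms f (H i))
mapAtoms f (F ⇒ G) = mapAtoms f F ⇒ mapAtoms f G

-- Sequents Γ ⇒ F with Γ a finite set of
-- formulas, represented by a list (only membership matters: rule W allows
-- passing to any list containing at least the same formulas).

data Deriv {A : Set} (Ax : Form A → Set₁) : List (Form A) → Form A → Set₁ where
  ax-id   : ∀ {F} → Deriv Ax (F ∷ []) F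
  ax-wem  : ∀ F G → Deriv Ax [] (F ∨∞ ((F ⇒ G) ∨∞ ¬∞ G))
  ax-dist : (I : Set) → I → (J : I → Set) → (H : (i : I) → J i → Form A) →
            Deriv Ax [] (⋀ I (λ i → ⋁ (J i) (H i))
                         ⇒ ⋁ ((i : I) → J i) (λ c → ⋀ I (λ i → H i (c i))))
  ax-extra : ∀ {F} → Ax F → Deriv Ax [] F
  ∧I : ∀ {Γ I H} → ((i : I) → Deriv Ax Γ (H i)) → Deriv Ax Γ (⋀ I H)
  ∧E : ∀ {Γ I H} → Deriv Ax Γ (⋀ I H) → (i : I) → Deriv Ax Γ (H i)
  ∨I : ∀ {Γ I H} → (i : I) → Deriv Ax Γ (H i) → Deriv Ax Γ (⋁ I H)
  ∨E : ∀ {Γ Δ I H F} → Deriv Ax Γ (⋁ I H) → ((i : I) → Deriv Ax (H i ∷ Δ) F) →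
       Deriv Ax (Γ ++ Δ) F
  ⇒I : ∀ {Γ F G} → Deriv Ax (F ∷ Γ) G → Deriv Ax Γ (F ⇒ G)
  ⇒E : ∀ {Γ Δ F G} → Deriv Ax Γ F → Deriv Ax Δ (F ⇒ G) → Deriv Ax (Γ ++ Δ) G
  W  : ∀ {Γ Δ F} → Deriv Ax Γ F → Γ ⊆ Δ → Deriv Ax Δ F

NoAx : {A : Set} → Form A → Set₁
NoAx _ = Lift _ ⊥

-- First-order language σ₀.
-- General variables and integer variables are two disjoint copies of ℕ.

data Cmp : Set where
  eq ne lt gt le ge : Cmp

holds : Cmp → PTerm → PTerm → Bool
holds eq a b = eqP a b
holds ne a b = not (eqP a b)
holds lt a b = ltP a b
holds gt a b = ltP b a
holds le a b = ltP a b ∨ eqP a b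
holds ge a b = ltP b a ∨ eqP a b

data ITerm : Set where
  ivar : ℕ → ITerm
  inum : ℤ → ITerm
  _⊕_ _⊖_ _⊗_ : ITerm → ITerm → ITerm

data GTerm : Set where
  gvar  : ℕ → GTerm
  const : PTerm → GTerm
  int   : ITerm → GTerm

data Form0 : Set where
  pred : ℕ → List GTerm → Form0                 -- p(t⃗), p/n with n = length
  cmp  : Cmp → GTerm → GTerm → Form0
  ⊥₀   : Form0
  _∧₀_ _∨₀_ _→₀_ : Form0 → Form0 → Form0
  ∀g ∃g : ℕ → Form0 → Form0
  ∀i ∃i : ℕ → Form0 → Form0

¬₀ : Form0 → Form0
¬₀ F = F →₀ ⊥₀

⊤₀ : Form0
⊤₀ = ¬₀ ⊥₀

remove : ℕ → List ℕ → List ℕ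
remove x [] = []
remove x (y ∷ ys) = if x ≡ᵇ y then remove x ys else y ∷ remove x ys

fviI : ITerm → List ℕ
fviI (ivar x) = x ∷ []
fviI (inum _) = []
fviI (a ⊕ b) = fviI a ++ fviI b
fviI (a ⊖ b) = fviI a ++ fviI b
fviI (a ⊗ b) = fviI a ++ fviI b

fvgT : GTerm → List ℕ
fvgT (gvar x) = x ∷ []
fvgT _ = []

fviT : GTerm → List ℕ
fviT (int t) = fviI t
fviT _ = []

fvg : Form0 → List ℕ
fvg (pred _ ts) = concatMap fvgT ts
fvg (cmp _ a b) = fvgT a ++ fvgT b
fvg ⊥₀ = []
fvg (F ∧₀ G) = fvg F ++ fvg G
fvg (F ∨₀ G) = fvg F ++ fvg G
fvg (F →₀ G) = fvg F ++ fvg G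
fvg (∀g x F) = remove x (fvg F)
fvg (∃g x F) = remove x (fvg F)
fvg (∀i _ F) = fvg F
fvg (∃i _ F) = fvg F

fvi : Form0 → List ℕ
fvi (pred _ ts) = concatMap fviT ts
fvi (cmp _ a b) = fviT a ++ fviT b
fvi ⊥₀ = []
fvi (F ∧₀ G) = fvi F ++ fvi G
fvi (F ∨₀ G) = fvi F ++ fvi G
fvi (F →₀ G) = fvi F ++ fvi G
fvi (∀g _ F) = fvi F
fvi (∃g _ F) = fvi F
fvi (∀i x F) = remove x (fvi F)
fvi (∃i x F) = remove x (fvi F)

allg : Form0 → List ℕ
allg (pred _ ts) = concatMap fvgT ts
allg (cmp _ a b) = fvgT a ++ fvgT b
allg ⊥₀ = []
allg (F ∧₀ G) = allg F ++ allg G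
allg (F ∨₀ G) = allg F ++ allg G
allg (F →₀ G) = allg F ++ allg G
allg (∀g x F) = x ∷ allg F
allg (∃g x F) = x ∷ allg F
allg (∀i _ F) = allg F
allg (∃i _ F) = allg F

Ren : Set
Ren = List (ℕ × ℕ)

lk : Ren → ℕ → ℕ
lk [] x = x
lk ((y , z) ∷ σ) x = if x ≡ᵇ y then z else lk σ x

del : ℕ → Ren → Ren
del x [] = []
del x ((y , z) ∷ σ) = if x ≡ᵇ y then del x σ else (y , z) ∷ del x σ

renT : Ren → GTerm → GTerm
renT σ (gvar x) = gvar (lk σ x)
renT σ t = t

ren : Ren → Form0 → Form0
ren σ (pred p ts) = pred p (map (renT σ) ts)
ren σ (cmp c a b) = cmp c (renT σ a) (renT σ b)
ren σ ⊥₀ = ⊥₀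
ren σ (F ∧₀ G) = ren σ F ∧₀ ren σ G
ren σ (F ∨₀ G) = ren σ F ∨₀ ren σ G
ren σ (F →₀ G) = ren σ F →₀ ren σ G
ren σ (∀g x F) = ∀g x (ren (del x σ) F)
ren σ (∃g x F) = ∃g x (ren (del x σ) F)
ren σ (∀i x F) = ∀i x (ren σ F)
ren σ (∃i x F) = ∃i x (ren σ F)

bigconj : List Form0 → Form0
bigconj [] = ⊤₀
bigconj (F ∷ []) = F
bigconj (F ∷ Fs) = F ∧₀ bigconj Fs

bigdisj : List Form0 → Form0
bigdisj [] = ⊥₀
bigdisj (F ∷ []) = F
bigdisj (F ∷ Fs) = F ∨₀ bigdisj Fs

maxL : List ℕ → ℕ
maxL = foldr _⊔_ 0

eqTup : List ℕ → List ℕ → Form0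
eqTup xs ys = bigconj (map (λ p → cmp eq (gvar (Data.Product.proj₁ p)) (gvar (Data.Product.proj₂ p))) (zip xs ys))

∃* : List ℕ → Form0 → Form0
∃* xs F = foldr ∃g F xs

∀* : List ℕ → Form0 → Form0
∀* xs F = foldr ∀g F xs

pairs : ℕ → List (ℕ × ℕ)
pairs n = concatMap (λ j → map (λ i → (i , j)) (upTo j)) (upTo n)

module Counting (X V : List ℕ) (F : Form0) where
  -- a base above every general variable of F, X, V: the tuples X_i are fresh
  base : ℕ
  base = suc (maxL (allg F ++ X ++ V))

  tup : ℕ → List ℕ
  tup i = map (λ j → base + i * length X + j) (upTo (length X))

  Fi : ℕ → Form0
  Fi i = ren (zip X (tup i)) F

  atLeastF : PTerm → Form0
  atLeastF (num (+ zero)) = ⊤₀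
  atLeastF (num (+ suc k)) =
    ∃* (concatMap tup (upTo (suc k)))
       (bigconj (map Fi (upTo (suc k)))
        ∧₀ bigconj (map (λ p → ¬₀ (eqTup (tup (Data.Product.proj₁ p)) (tup (Data.Product.proj₂ p))))
                        (pairs (suc k))))
  atLeastF (num -[1+ _ ]) = ⊤₀
  atLeastF inf = ⊤₀
  atLeastF (sym _) = ⊥₀
  atLeastF sup = ⊥₀

  atMostF : PTerm → Form0
  atMostF (num (+ k)) =
    ∀* (concatMap tup (upTo (suc k)))
       (bigconj (map Fi (upTo (suc k)))
        →₀ bigdisj (map (λ p → eqTup (tup (Data.Product.proj₁ p)) (tup (Data.Product.proj₂ p)))
                        (pairs (suc k))))
  atMostF (num -[1+ _ ]) = ⊥₀
  atMostF inf = ⊥₀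
  atMostF (sym _) = ⊤₀
  atMostF sup = ⊤₀

WF : List ℕ → List ℕ → Form0 → Set
WF X V F = Unique (X ++ V) × (fvg F ⊆ X ++ V) × (fvi F ≡ [])

record CPred : Set where
  constructor cpred
  field
    X V : List ℕ
    F   : Form0
    .wf : WF X V F

data Form1 : Set where
  pred : ℕ → List GTerm → Form1
  cmp  : Cmp → GTerm → GTerm → Form1
  ⊥₁   : Form1
  _∧₁_ _∨₁_ _→₁_ : Form1 → Form1 → Form1
  ∀g ∃g : ℕ → Form1 → Form1
  ∀i ∃i : ℕ → Form1 → Form1
  atleast atmost : (c : CPred) → Vec GTerm (length (CPred.V c)) → GTerm → Form1

lift0 : Form0 → Form1
lift0 (pred p ts) = pred p ts
lift0 (cmp c a b) = cmp c a b
lift0 ⊥₀ = ⊥₁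
lift0 (F ∧₀ G) = lift0 F ∧₁ lift0 G
lift0 (F ∨₀ G) = lift0 F ∨₁ lift0 G
lift0 (F →₀ G) = lift0 F →₁ lift0 G
lift0 (∀g x F) = ∀g x (lift0 F)
lift0 (∃g x F) = ∃g x (lift0 F)
lift0 (∀i x F) = ∀i x (lift0 F)
lift0 (∃i x F) = ∃i x (lift0 F)

_↔₁_ : Form1 → Form1 → Form1
F ↔₁ G = (F →₁ G) ∧₁ (G →₁ F)

∀*₁ : List ℕ → Form1 → Form1
∀*₁ xs F = foldr ∀g F xs

defAtleast : CPred → PTerm → Form1
defAtleast c r = ∀*₁ V (atleast c (Vec.map gvar (Vec.fromList V)) (const r)
                        ↔₁ lift0 (Counting.atLeastF X V F r))
  where open CPred c

defAtmost : CPred → PTerm → Form1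
defAtmost c r = ∀*₁ V (atmost c (Vec.map gvar (Vec.fromList V)) (const r)
                       ↔₁ lift0 (Counting.atMostF X V F r))
  where open CPred c

data InDefs : Form1 → Set where
  dAtleast : (c : CPred) (r : PTerm) → InDefs (defAtleast c r)
  dAtmost  : (c : CPred) (r : PTerm) → InDefs (defAtmost c r)

data CAtom : Set where
  atleastA atmostA : (c : CPred) → Vec PTerm (length (CPred.V c)) → PTerm → CAtom

Atom1 : Set
Atom1 = PAtom ⊎ CAtom

-- variable assignment (only used to carry the values substituted by the
-- quantifier clauses; on sentences gr does not depend on it)
record Env : Set where
  constructor env
  field
    gv : ℕ → PTerm
    iv : ℕ → ℤ

setG : Env → ℕ → PTerm → Env
setG (env g i) x r = env (λ y → if y ≡ᵇ x then r else g y) i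

setI : Env → ℕ → ℤ → Env
setI (env g i) x n = env g (λ y → if y ≡ᵇ x then n else i y)

evalI : Env → ITerm → ℤ
evalI ρ (ivar x) = Env.iv ρ x
evalI ρ (inum n) = n
evalI ρ (a ⊕ b) = evalI ρ a ℤ.+ evalI ρ b
evalI ρ (a ⊖ b) = evalI ρ a ℤ.- evalI ρ b
evalI ρ (a ⊗ b) = evalI ρ a ℤ.* evalI ρ b

evalG : Env → GTerm → PTerm
evalG ρ (gvar x) = Env.gv ρ x
evalG ρ (const r) = r
evalG ρ (int t) = num (evalI ρ t)

gr' : Env → Form1 → Form Atom1
gr' ρ (pred p ts) = atom (inj₁ (patom p (map (evalG ρ) ts)))
gr' ρ (cmp c a b) = if holds c (evalG ρ a) (evalG ρ b) then ⊤∞ else ⊥∞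
gr' ρ ⊥₁ = ⊥∞
gr' ρ (F ∧₁ G) = gr' ρ F ∧∞ gr' ρ G
gr' ρ (F ∨₁ G) = gr' ρ F ∨∞ gr' ρ G
gr' ρ (F →₁ G) = gr' ρ F ⇒ gr' ρ G
gr' ρ (∀g x F) = ⋀ PTerm (λ r → gr' (setG ρ x r) F)
gr' ρ (∃g x F) = ⋁ PTerm (λ r → gr' (setG ρ x r) F)
gr' ρ (∀i x F) = ⋀ ℤ (λ n → gr' (setI ρ x n) F)
gr' ρ (∃i x F) = ⋁ ℤ (λ n → gr' (setI ρ x n) F)
gr' ρ (atleast c ts t) = atom (inj₂ (atleastA c (Vec.map (evalG ρ) ts) (evalG ρ t)))
gr' ρ (atmost c ts t) = atom (inj₂ (atmostA c (Vec.map (evalG ρ) ts) (evalG ρ t)))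

ρ₀ : Env
ρ₀ = env (λ _ → inf) (λ _ → + 0)

gr : Form1 → Form Atom1
gr = gr' ρ₀

data GrDefs : Form Atom1 → Set₁ where
  grDef : ∀ {D} → InDefs D → GrDefs (gr D)

embed : Form PAtom → Form Atom1
embed = mapAtoms inj₁

module Submission where

-- Replace every ground atom Atleast(v⃗, r) / Atmost(v⃗, r) by the grounding of
-- its defining counting formula at V := v⃗.  Substituting formulas for atoms
-- preserves HT^∞-derivability, it turns each axiom of gr(Defs) into a
-- conjunction of instances of F ↔ F, and it fixes every formula over
-- precomputed atoms.  So a derivation in HT^∞ + gr(Defs) becomes one in HT^∞.

open import Defs hiding (sym)
open import Data.Bool using (true; false; T; if_then_else_)
open import Data.Nat using (ℕ; _≡ᵇ_)
open import Data.Nat.Properties using (≡ᵇ⇒≡; ≡⇒≡ᵇ)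
open import Data.Integer as ℤ using (ℤ; +_)
open import Data.Product using (_×_; _,_)
open import Data.Sum using (inj₁; inj₂)
open import Data.List using (List; []; _∷_; map)
open import Data.List.Properties using (map-++; ++-identityʳ; map-cong)
open import Data.List.Relation.Unary.Any using (here; there)
open import Data.List.Membership.Propositional using (_∈_; _∉_)
open import Data.List.Membership.Propositional.Properties using (∈-map⁺; ∈-map⁻)
open import Data.List.Relation.Binary.Subset.Propositional using (_⊆_)
import Data.Vec as Vec
open import Function using (_∘_)
open import Relation.Nullary using (contradiction)
open import Relation.Binary.PropositionalEquality
  using (_≡_; _≢_; refl; sym; trans; cong; cong₂; subst; _≗_)

-- Two formulas are ≋ when they agree up to pointwise equality of their index
-- families; without function extensionality ≡ cannot identify them.
data _≋_ {A : Set} : Form A → Form A → Set₁ where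
  atom-≋ : ∀ {a b} → a ≡ b → atom a ≋ atom b
  ⋀-≋ : ∀ {I H H'} → ((i : I) → H i ≋ H' i) → ⋀ I H ≋ ⋀ I H'
  ⋁-≋ : ∀ {I H H'} → ((i : I) → H i ≋ H' i) → ⋁ I H ≋ ⋁ I H'
  ⇒-≋ : ∀ {F F' G G'} → F ≋ F' → G ≋ G' → (F ⇒ G) ≋ (F' ⇒ G')

infix 4 _≋_

module _ {A : Set} where

  ≋-refl : (F : Form A) → F ≋ F
  ≋-refl (atom a) = atom-≋ refl
  ≋-refl (⋀ I H) = ⋀-≋ (λ i → ≋-refl (H i))
  ≋-refl (⋁ I H) = ⋁-≋ (λ i → ≋-refl (H i))
  ≋-refl (F ⇒ G) = ⇒-≋ (≋-refl F) (≋-refl G)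

  ≋-sym : {F G : Form A} → F ≋ G → G ≋ F
  ≋-sym (atom-≋ e) = atom-≋ (sym e)
  ≋-sym (⋀-≋ f) = ⋀-≋ (λ i → ≋-sym (f i))
  ≋-sym (⋁-≋ f) = ⋁-≋ (λ i → ≋-sym (f i))
  ≋-sym (⇒-≋ a b) = ⇒-≋ (≋-sym a) (≋-sym b)

  ≋-trans : {F G K : Form A} → F ≋ G → G ≋ K → F ≋ K
  ≋-trans (atom-≋ e) (atom-≋ e') = atom-≋ (trans e e')
  ≋-trans (⋀-≋ f) (⋀-≋ g) = ⋀-≋ (λ i → ≋-trans (f i) (g i))
  ≋-trans (⋁-≋ f) (⋁-≋ g) = ⋁-≋ (λ i → ≋-trans (f i) (g i))
  ≋-trans (⇒-≋ a b) (⇒-≋ c d) = ⇒-≋ (≋-trans a c) (≋-trans b d)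

  ≋⇒entails : ∀ {Ax} {F G : Form A} → F ≋ G → Deriv Ax (F ∷ []) G
  ≋⇒entails (atom-≋ refl) = ax-id
  ≋⇒entails (⋀-≋ f) = ∧I (λ i → ⇒E (∧E ax-id i) (⇒I (≋⇒entails (f i))))
  ≋⇒entails (⋁-≋ f) = ∨E {Δ = []} ax-id (λ i → ∨I i (≋⇒entails (f i)))
  ≋⇒entails (⇒-≋ a b) = ⇒I (⇒E (⇒E (≋⇒entails (≋-sym a)) ax-id) (⇒I (≋⇒entails b)))

  Deriv-≋ : ∀ {Ax Γ} {F G : Form A} → Deriv Ax Γ F → F ≋ G → Deriv Ax Γ G
  Deriv-≋ {Γ = Γ} {G = G} d e =
    subst (λ Δ → Deriv _ Δ G) (++-identityʳ Γ) (⇒E d (⇒I (≋⇒entails e)))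

substAtoms : {A B : Set} → (A → Form B) → Form A → Form B
substAtoms σ (atom a) = σ a
substAtoms σ (⋀ I H) = ⋀ I (λ i → substAtoms σ (H i))
substAtoms σ (⋁ I H) = ⋁ I (λ i → substAtoms σ (H i))
substAtoms σ (F ⇒ G) = substAtoms σ F ⇒ substAtoms σ G

module _ {A B : Set} (σ : A → Form B) where

  substAtoms-mapAtoms : {f : B → A} → σ ∘ f ≗ atom →
                        (F : Form B) → substAtoms σ (mapAtoms f F) ≋ F
  substAtoms-mapAtoms σf≗atom (atom a) = subst (_≋ atom a) (sym (σf≗atom a)) (≋-refl _)
  substAtoms-mapAtoms σf≗atom (⋀ I H) = ⋀-≋ (λ i → substAtoms-mapAtoms σf≗atom (H i))
  substAtoms-mapAtoms σf≗atom (⋁ I H) = ⋁-≋ (λ i → substAtoms-mapAtoms σf≗atom (H i))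
  substAtoms-mapAtoms σf≗atom (F ⇒ G) =
    ⇒-≋ (substAtoms-mapAtoms σf≗atom F) (substAtoms-mapAtoms σf≗atom G)

  substAtoms-wem : ∀ F G → substAtoms σ F ∨∞ ((substAtoms σ F ⇒ substAtoms σ G) ∨∞ ¬∞ (substAtoms σ G))
                           ≋ substAtoms σ (F ∨∞ ((F ⇒ G) ∨∞ ¬∞ G))
  substAtoms-wem F G = ⋁-≋ λ
    { true → ≋-refl _
    ; false → ⋁-≋ λ { true → ≋-refl _ ; false → ⇒-≋ (≋-refl _) (⋁-≋ λ ()) } }

  map-substAtoms-⊆ : {Γ Δ : List (Form A)} → Γ ⊆ Δ → map (substAtoms σ) Γ ⊆ map (substAtoms σ) Δ
  map-substAtoms-⊆ Γ⊆Δ y∈ with ∈-map⁻ (substAtoms σ) y∈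
  ... | _ , x∈ , refl = ∈-map⁺ (substAtoms σ) (Γ⊆Δ x∈)

  Deriv-substAtoms : ∀ {Ax : Form A → Set₁} {Ax' : Form B → Set₁} →
    (∀ {F} → Ax F → Deriv Ax' [] (substAtoms σ F)) →
    ∀ {Γ F} → Deriv Ax Γ F → Deriv Ax' (map (substAtoms σ) Γ) (substAtoms σ F)
  Deriv-substAtoms ax = go
    where
    go : ∀ {Γ F} → Deriv _ Γ F → Deriv _ (map (substAtoms σ) Γ) (substAtoms σ F)
    go ax-id = ax-id
    go (ax-wem F G) = Deriv-≋ (ax-wem (substAtoms σ F) (substAtoms σ G)) (substAtoms-wem F G)
    go (ax-dist I i J H) = ax-dist I i J (λ i j → substAtoms σ (H i j))
    go (ax-extra p) = ax p
    go (∧I f) = ∧I (λ i → go (f i))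
    go (∧E d i) = ∧E (go d) i
    go (∨I i d) = ∨I i (go d)
    go (∨E {Γ} {Δ} d f) =
      subst (λ Θ → Deriv _ Θ _) (sym (map-++ (substAtoms σ) Γ Δ)) (∨E (go d) (λ i → go (f i)))
    go (⇒I d) = ⇒I (go d)
    go (⇒E {Γ} {Δ} d e) =
      subst (λ Θ → Deriv _ Θ _) (sym (map-++ (substAtoms σ) Γ Δ)) (⇒E (go d) (go e))
    go (W d Γ⊆Δ) = W (go d) (map-substAtoms-⊆ Γ⊆Δ)

gr₀ : Env → Form0 → Form PAtom
gr₀ ρ (pred p ts) = atom (patom p (map (evalG ρ) ts))
gr₀ ρ (cmp c a b) = if holds c (evalG ρ a) (evalG ρ b) then ⊤∞ else ⊥∞
gr₀ ρ ⊥₀ = ⊥∞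
gr₀ ρ (F ∧₀ G) = gr₀ ρ F ∧∞ gr₀ ρ G
gr₀ ρ (F ∨₀ G) = gr₀ ρ F ∨∞ gr₀ ρ G
gr₀ ρ (F →₀ G) = gr₀ ρ F ⇒ gr₀ ρ G
gr₀ ρ (∀g x F) = ⋀ PTerm (λ r → gr₀ (setG ρ x r) F)
gr₀ ρ (∃g x F) = ⋁ PTerm (λ r → gr₀ (setG ρ x r) F)
gr₀ ρ (∀i x F) = ⋀ ℤ (λ n → gr₀ (setI ρ x n) F)
gr₀ ρ (∃i x F) = ⋁ ℤ (λ n → gr₀ (setI ρ x n) F)

record _≈ᴱ_ (ρ ρ' : Env) : Set where
  field
    gv≗ : Env.gv ρ ≗ Env.gv ρ'
    iv≗ : Env.iv ρ ≗ Env.iv ρ'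
open _≈ᴱ_

module _ {ρ ρ' : Env} (ρ≈ρ' : ρ ≈ᴱ ρ') where

  evalI-≈ᴱ : evalI ρ ≗ evalI ρ'
  evalI-≈ᴱ (ivar x) = iv≗ ρ≈ρ' x
  evalI-≈ᴱ (inum n) = refl
  evalI-≈ᴱ (a ⊕ b) = cong₂ ℤ._+_ (evalI-≈ᴱ a) (evalI-≈ᴱ b)
  evalI-≈ᴱ (a ⊖ b) = cong₂ ℤ._-_ (evalI-≈ᴱ a) (evalI-≈ᴱ b)
  evalI-≈ᴱ (a ⊗ b) = cong₂ ℤ._*_ (evalI-≈ᴱ a) (evalI-≈ᴱ b)

  evalG-≈ᴱ : evalG ρ ≗ evalG ρ'
  evalG-≈ᴱ (gvar x) = gv≗ ρ≈ρ' x
  evalG-≈ᴱ (const r) = refl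
  evalG-≈ᴱ (int t) = cong num (evalI-≈ᴱ t)

  setG-≈ᴱ : ∀ x r → setG ρ x r ≈ᴱ setG ρ' x r
  setG-≈ᴱ x r = record { gv≗ = updated ; iv≗ = iv≗ ρ≈ρ' }
    where
    updated : ∀ y → (if y ≡ᵇ x then r else Env.gv ρ y) ≡ (if y ≡ᵇ x then r else Env.gv ρ' y)
    updated y with y ≡ᵇ x
    ... | true = refl
    ... | false = gv≗ ρ≈ρ' y

  setI-≈ᴱ : ∀ x n → setI ρ x n ≈ᴱ setI ρ' x n
  setI-≈ᴱ x n = record { gv≗ = gv≗ ρ≈ρ' ; iv≗ = updated }
    where
    updated : ∀ y → (if y ≡ᵇ x then n else Env.iv ρ y) ≡ (if y ≡ᵇ x then n else Env.iv ρ' y)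
    updated y with y ≡ᵇ x
    ... | true = refl
    ... | false = iv≗ ρ≈ρ' y

gr₀-≈ᴱ : ∀ {ρ ρ'} → ρ ≈ᴱ ρ' → ∀ G → gr₀ ρ G ≋ gr₀ ρ' G
gr₀-≈ᴱ ρ≈ρ' (pred p ts) = atom-≋ (cong (patom p) (map-cong (evalG-≈ᴱ ρ≈ρ') ts))
gr₀-≈ᴱ ρ≈ρ' (cmp c a b) rewrite evalG-≈ᴱ ρ≈ρ' a | evalG-≈ᴱ ρ≈ρ' b = ≋-refl _
gr₀-≈ᴱ ρ≈ρ' ⊥₀ = ≋-refl _
gr₀-≈ᴱ ρ≈ρ' (F ∧₀ G) = ⋀-≋ λ { true → gr₀-≈ᴱ ρ≈ρ' F ; false → gr₀-≈ᴱ ρ≈ρ' G }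
gr₀-≈ᴱ ρ≈ρ' (F ∨₀ G) = ⋁-≋ λ { true → gr₀-≈ᴱ ρ≈ρ' F ; false → gr₀-≈ᴱ ρ≈ρ' G }
gr₀-≈ᴱ ρ≈ρ' (F →₀ G) = ⇒-≋ (gr₀-≈ᴱ ρ≈ρ' F) (gr₀-≈ᴱ ρ≈ρ' G)
gr₀-≈ᴱ ρ≈ρ' (∀g x F) = ⋀-≋ (λ r → gr₀-≈ᴱ (setG-≈ᴱ ρ≈ρ' x r) F)
gr₀-≈ᴱ ρ≈ρ' (∃g x F) = ⋁-≋ (λ r → gr₀-≈ᴱ (setG-≈ᴱ ρ≈ρ' x r) F)
gr₀-≈ᴱ ρ≈ρ' (∀i x F) = ⋀-≋ (λ n → gr₀-≈ᴱ (setI-≈ᴱ ρ≈ρ' x n) F)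
gr₀-≈ᴱ ρ≈ρ' (∃i x F) = ⋁-≋ (λ n → gr₀-≈ᴱ (setI-≈ᴱ ρ≈ρ' x n) F)

≡ᵇ-true⇒≡ : ∀ {x v} → (x ≡ᵇ v) ≡ true → x ≡ v
≡ᵇ-true⇒≡ {x} {v} x≡ᵇv = ≡ᵇ⇒≡ x v (subst T (sym x≡ᵇv) _)

≡ᵇ-false⇒≢ : ∀ {x v} → (x ≡ᵇ v) ≡ false → x ≢ v
≡ᵇ-false⇒≢ {x} {v} x≡ᵇv x≡v = subst T x≡ᵇv (≡⇒≡ᵇ x v x≡v)

lookupV : List ℕ → List PTerm → ℕ → PTerm
lookupV (v ∷ V) (r ∷ rs) x = if x ≡ᵇ v then r else lookupV V rs x
lookupV _ _ x = inf

lookupV-map : ∀ V (g : ℕ → PTerm) x → (x ∉ V → g x ≡ inf) → lookupV V (map g V) x ≡ g x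
lookupV-map [] g x outside = sym (outside λ ())
lookupV-map (v ∷ V) g x outside with x ≡ᵇ v in x≡ᵇv
... | true = cong g (sym (≡ᵇ-true⇒≡ x≡ᵇv))
... | false = lookupV-map V g x λ x∉V →
  outside λ { (here x≡v) → ≡ᵇ-false⇒≢ x≡ᵇv x≡v ; (there x∈V) → x∉V x∈V }

envOn : List ℕ → List PTerm → Env
envOn V rs = env (lookupV V rs) (λ _ → + 0)

SupportedOn : List ℕ → Env → Set
SupportedOn V ρ = (∀ x → x ∉ V → Env.gv ρ x ≡ inf) × (∀ x → Env.iv ρ x ≡ + 0)

setG-SupportedOn : ∀ {V ρ v} r → v ∈ V → SupportedOn V ρ → SupportedOn V (setG ρ v r)
setG-SupportedOn {V} {ρ} {v} r v∈V (outside , iv≡0) = gv-outside , iv≡0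
  where
  gv-outside : ∀ x → x ∉ V → (if x ≡ᵇ v then r else Env.gv ρ x) ≡ inf
  gv-outside x x∉V with x ≡ᵇ v in x≡ᵇv
  ... | true = contradiction (subst (_∈ V) (sym (≡ᵇ-true⇒≡ x≡ᵇv)) v∈V) x∉V
  ... | false = outside x x∉V

-- the values of the variables V under ρ, as they appear in the argument
-- tuple of a ground counting atom
boundValues : List ℕ → Env → List PTerm
boundValues V ρ = Vec.toList (Vec.map (evalG ρ) (Vec.map gvar (Vec.fromList V)))

boundValues-map : ∀ V ρ → boundValues V ρ ≡ map (Env.gv ρ) V
boundValues-map [] ρ = refl
boundValues-map (v ∷ V) ρ = cong (Env.gv ρ v ∷_) (boundValues-map V ρ)

envOn-boundValues : ∀ {V ρ} → SupportedOn V ρ → envOn V (boundValues V ρ) ≈ᴱ ρ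
envOn-boundValues {V} {ρ} (outside , iv≡0) = record
  { gv≗ = λ x → trans (cong (λ rs → lookupV V rs x) (boundValues-map V ρ))
                      (lookupV-map V (Env.gv ρ) x (outside x))
  ; iv≗ = λ x → sym (iv≡0 x) }

unfold : Atom1 → Form PAtom
unfold (inj₁ a) = atom a
unfold (inj₂ (atleastA (cpred X V F _) vs r)) = gr₀ (envOn V (Vec.toList vs)) (Counting.atLeastF X V F r)
unfold (inj₂ (atmostA (cpred X V F _) vs r)) = gr₀ (envOn V (Vec.toList vs)) (Counting.atMostF X V F r)

unfold-if : ∀ b → substAtoms unfold (if b then ⊤∞ else ⊥∞) ≋ (if b then ⊤∞ else ⊥∞)
unfold-if true = ⋀-≋ λ ()
unfold-if false = ⋁-≋ λ ()

unfold-gr-lift0 : ∀ ρ G → substAtoms unfold (gr' ρ (lift0 G)) ≋ gr₀ ρ G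
unfold-gr-lift0 ρ (pred p ts) = ≋-refl _
unfold-gr-lift0 ρ (cmp c a b) = unfold-if (holds c (evalG ρ a) (evalG ρ b))
unfold-gr-lift0 ρ ⊥₀ = ⋁-≋ λ ()
unfold-gr-lift0 ρ (F ∧₀ G) = ⋀-≋ λ { true → unfold-gr-lift0 ρ F ; false → unfold-gr-lift0 ρ G }
unfold-gr-lift0 ρ (F ∨₀ G) = ⋁-≋ λ { true → unfold-gr-lift0 ρ F ; false → unfold-gr-lift0 ρ G }
unfold-gr-lift0 ρ (F →₀ G) = ⇒-≋ (unfold-gr-lift0 ρ F) (unfold-gr-lift0 ρ G)
unfold-gr-lift0 ρ (∀g x F) = ⋀-≋ (λ r → unfold-gr-lift0 (setG ρ x r) F)
unfold-gr-lift0 ρ (∃g x F) = ⋁-≋ (λ r → unfold-gr-lift0 (setG ρ x r) F)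
unfold-gr-lift0 ρ (∀i x F) = ⋀-≋ (λ n → unfold-gr-lift0 (setI ρ x n) F)
unfold-gr-lift0 ρ (∃i x F) = ⋁-≋ (λ n → unfold-gr-lift0 (setI ρ x n) F)

module _ {A : Set} {Ax : Form A → Set₁} (σ : Atom1 → Form A) where

  gr-↔₁ : ∀ {ρ F G} → substAtoms σ (gr' ρ F) ≋ substAtoms σ (gr' ρ G) →
          Deriv Ax [] (substAtoms σ (gr' ρ (F ↔₁ G)))
  gr-↔₁ F≋G = ∧I λ { true → ⇒I (Deriv-≋ ax-id F≋G) ; false → ⇒I (Deriv-≋ ax-id (≋-sym F≋G)) }

  gr-∀*₁ : (P : Env → Set) → ∀ Vs G →
           (∀ {ρ v} r → v ∈ Vs → P ρ → P (setG ρ v r)) →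
           (∀ {ρ} → P ρ → Deriv Ax [] (substAtoms σ (gr' ρ G))) →
           ∀ {ρ} → P ρ → Deriv Ax [] (substAtoms σ (gr' ρ (∀*₁ Vs G)))
  gr-∀*₁ P [] G _ prove Pρ = prove Pρ
  gr-∀*₁ P (v ∷ Vs) G closed prove Pρ =
    ∧I λ r → gr-∀*₁ P Vs G (λ r' v'∈ → closed r' (there v'∈)) prove (closed r (here refl) Pρ)

-- Both kinds of axioms of Defs are an instance of this, with the counting
-- atom as A; the premise then holds definitionally.
unfold-defining : ∀ V (A : Form1) (body : Form0) →
  (∀ ρ → substAtoms unfold (gr' ρ A) ≡ gr₀ (envOn V (boundValues V ρ)) body) →
  Deriv NoAx [] (substAtoms unfold (gr (∀*₁ V (A ↔₁ lift0 body))))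
unfold-defining V A body unfold-A =
  gr-∀*₁ unfold (SupportedOn V) V (A ↔₁ lift0 body) setG-SupportedOn
    (λ {ρ} supp → gr-↔₁ unfold {ρ} {A} {lift0 body} (unfold-A≋ ρ supp))
    ((λ _ _ → refl) , (λ _ → refl))
  where
  unfold-A≋ : ∀ ρ → SupportedOn V ρ →
              substAtoms unfold (gr' ρ A) ≋ substAtoms unfold (gr' ρ (lift0 body))
  unfold-A≋ ρ supp = subst (_≋ _) (sym (unfold-A ρ))
    (≋-trans (gr₀-≈ᴱ (envOn-boundValues supp) body) (≋-sym (unfold-gr-lift0 ρ body)))

unfold-GrDefs : ∀ {G} → GrDefs G → Deriv NoAx [] (substAtoms unfold G)
unfold-GrDefs (grDef (dAtleast c r)) = unfold-defining (CPred.V c) _ _ (λ _ → refl)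
unfold-GrDefs (grDef (dAtmost c r)) = unfold-defining (CPred.V c) _ _ (λ _ → refl)

lemma4 : (F : Form PAtom) → Deriv GrDefs [] (embed F) → Deriv NoAx [] F
lemma4 F d =
  Deriv-≋ (Deriv-substAtoms unfold unfold-GrDefs d) (substAtoms-mapAtoms unfold (λ _ → refl) F)
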